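{- Let $m,k\in\mathbb{N}$ with $k>m$. Then the number of exact covering systems consisting of exactly $k$ congruence classes and having exactly two distinct moduli, one of which is $m$ and the other of which is a multiple of $m$, is exactly $$\sum_{\substack{d\mid k-m\\ d<m}}\binom{m}{d}.$$
   Context: For $a,m\in\mathbb{Z}$ with $m\geq 2$, the congruence class $a \pmod m$ is the set of integers congruent to $a$ modulo $m$. A system of congruences is a finite set of congruence classes $\{r_1 \pmod{m_1},\dots,r_k \pmod{m_k}\}$ (each modulus at least $2$; moduli may repeat). It is a covering system if every integer lies in at least one of the classes, and it is exact if the $k$ congruence classes are pairwise disjoint. Systems are counted as sets of congruence classes. -}

module Defs where

open import Data.Nat using (ℕ; _<_; _≤_)
open import Data.Nat.Divisibility using (_∣_; _∣?_)
open import Data.Nat.Combinatorics using (_C_)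
open import Data.Integer as ℤ using (ℤ; +_)
import Data.Integer.Divisibility as ℤD
open import Data.List using (List; length; map; filter; upTo)
open import Data.Nat.ListAction using (sum)
open import Data.List.Relation.Unary.All using (All)
open import Data.List.Relation.Unary.Any using (Any)
open import Data.List.Relation.Unary.AllPairs using (AllPairs)
open import Data.List.Relation.Unary.Linked using (Linked)
open import Data.Product using (_×_; _,_; Σ; proj₁; proj₂)
open import Data.Sum using (_⊎_)
open import Relation.Binary.PropositionalEquality using (_≡_; _≢_)
open import Relation.Nullary using (¬_)

-- A congruence class r (mod n), represented by the pair (n , r).
-- Canonical representatives: n ≥ 2 and 0 ≤ r < n.  Two canonical
-- pairs denote the same set of integers iff they are equal.
Class : Set
Class = ℕ × ℕ

modulus : Class → ℕ
modulus = proj₁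

residue : Class → ℕ
residue = proj₂

Canonical : Class → Set
Canonical (n , r) = 2 ≤ n × r < n

_∈ᶜ_ : ℤ → Class → Set
z ∈ᶜ (n , r) = (+ n) ℤD.∣ (z ℤ.- (+ r))

_<ᶜ_ : Class → Class → Set
(n , r) <ᶜ (n′ , r′) = n < n′ ⊎ (n ≡ n′ × r < r′)

-- A system of congruences (a finite SET of classes), represented
-- canonically as a strictly increasing list of canonical pairs.
IsSystem : List Class → Set
IsSystem S = All Canonical S × Linked _<ᶜ_ S

Covering : List Class → Set
Covering S = (z : ℤ) → Any (z ∈ᶜ_) S

Exact : List Class → Set
Exact S = AllPairs (λ c c′ → (z : ℤ) → ¬ (z ∈ᶜ c × z ∈ᶜ c′)) S

TwoModuli : ℕ → List Class → Set
TwoModuli m S = Σ ℕ λ M → M ≢ m × m ∣ M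
  × All (λ c → modulus c ≡ m ⊎ modulus c ≡ M) S
  × Any (λ c → modulus c ≡ m) S
  × Any (λ c → modulus c ≡ M) S

Counted : ℕ → ℕ → List Class → Set
Counted m k S = IsSystem S × Covering S × Exact S × length S ≡ k × TwoModuli m S

formula : ℕ → ℕ → ℕ
formula m k = sum (map (λ d → m C d) (filter (λ d → d ∣? (k Data.Nat.∸ m)) (upTo m)))

-- An exact covering system S with moduli m and M = (1 + q) m is determined by the set P of
-- residues r mod m whose class r (mod m) is not in S: by exactness no class mod M lies over a
-- residue outside P, and by covering every class s (mod M) over a residue in P belongs to S.
-- Hence S has (m − |P|) + (1 + q) |P| = m + q |P| classes, so d = |P| is a divisor of k − m
-- with 0 < d < m, and it determines q.  Conversely every such d and every d-subset P give an
-- exact covering system, so the systems are counted by the sum of (m choose d).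

module Submission where

open import Defs
open import Data.Bool using (Bool; true; false; T; not)
open import Data.Bool.Properties using (T?)
open import Data.Integer as ℤ using (ℤ; _⊖_)
import Data.Integer.Properties as ℤ
open import Data.Integer.DivMod using (_%ℕ_; _/ℕ_; n%ℕd<d; a≡a%ℕn+[a/ℕn]*n)
import Data.Integer.Divisibility.Signed as ℤˢ
open import Data.Integer.Tactic.RingSolver using (solve-∀)
open import Data.List using (List; []; _∷_; _++_; map; filter; length; upTo; applyUpTo; concatMap)
open import Data.List.Properties
  using (∷-injectiveʳ; length-++; length-map; length-upTo; length-applyUpTo; filter-++; filter-some; map-upTo)
open import Data.List.Membership.Propositional using (_∈_; _∉_; find; lose)
open import Data.List.Membership.Propositional.Properties
  using (∈-++⁺ˡ; ∈-++⁺ʳ; ∈-++⁻; ∈-map⁺; ∈-map⁻; ∈-filter⁺; ∈-filter⁻; ∈-upTo⁺; ∈-upTo⁻; ∈-concatMap⁺; ∈-concatMap⁻)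
open import Data.List.Relation.Binary.Disjoint.Propositional using (Disjoint)
open import Data.List.Relation.Binary.Subset.Propositional using (_⊆_)
open import Data.List.Relation.Unary.All as All using (All; []; _∷_)
import Data.List.Relation.Unary.All.Properties as All
open import Data.List.Relation.Unary.AllPairs as AllPairs using (AllPairs; []; _∷_)
import Data.List.Relation.Unary.AllPairs.Properties as AllPairs
open import Data.List.Relation.Unary.Any using (Any; here; there)
open import Data.List.Relation.Unary.Linked.Properties using (AllPairs⇒Linked; Linked⇒AllPairs)
open import Data.List.Relation.Unary.Unique.Propositional using (Unique)
import Data.List.Relation.Unary.Unique.Propositional.Properties as Unique
open import Data.Nat using (ℕ; zero; suc; _+_; _*_; _∸_; _<_; _≤_; z≤n; s≤s; NonZero; >-nonZero; >-nonZero⁻¹)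
open import Data.Nat.Properties
open import Data.Nat.Combinatorics using (_C_; nCk+nC[k+1]≡[n+1]C[k+1])
open import Data.Nat.DivMod using (_%_; m%n<n; m<n⇒m%n≡m; %-remove-+ˡ)
open import Data.Nat.Divisibility as ℕ using (_∣_; _∣?_; divides; ∣-refl)
open import Data.Nat.ListAction using (sum)
open import Data.Product using (Σ; ∃; ∃₂; _×_; _,_; _,′_; proj₁; proj₂; swap)
open import Data.Product.Properties using (≡-dec)
open import Data.List.Membership.DecPropositional (≡-dec _≟_ _≟_) using (_∈?_)
open import Data.Product.Relation.Binary.Lex.Strict using (×-isStrictPartialOrder)
open import Data.Sum using (_⊎_; inj₁; inj₂)
open import Function using (_∘_; id)
open import Function.Bundles using (_⇔_; mk⇔)
open import Relation.Binary.Definitions using (Asymmetric)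
open import Relation.Binary.PropositionalEquality
open import Relation.Binary.Structures using (IsStrictPartialOrder)
open import Relation.Nullary using (¬_; Dec; yes; no; does; ¬?; contradiction; decidable-stable)
open import Relation.Unary using (Decidable)

private variable
  A B : Set
  P Q : ℕ → Set

filter-map : {P : B → Set} (P? : Decidable P) (f : A → B) (xs : List A) →
             filter P? (map f xs) ≡ map f (filter (P? ∘ f) xs)
filter-map P? f []       = refl
filter-map P? f (x ∷ xs) with does (P? (f x))
... | true  = cong (f x ∷_) (filter-map P? f xs)
... | false = filter-map P? f xs

filter-cong : {P Q : A → Set} (P? : Decidable P) (Q? : Decidable Q) {xs : List A} →
              All (λ x → does (P? x) ≡ does (Q? x)) xs → filter P? xs ≡ filter Q? xs
filter-cong P? Q? []                     = refl
filter-cong P? Q? {x ∷ _} (agree ∷ rest) with does (P? x) | does (Q? x) | agree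
... | true  | .true  | refl = cong (x ∷_) (filter-cong P? Q? rest)
... | false | .false | refl = filter-cong P? Q? rest

length-filter-¬ : {P : A → Set} (P? : Decidable P) (xs : List A) →
                  length (filter P? xs) + length (filter (¬? ∘ P?) xs) ≡ length xs
length-filter-¬ P? []       = refl
length-filter-¬ P? (x ∷ xs) with does (P? x)
... | true  = cong suc (length-filter-¬ P? xs)
... | false = trans (+-suc _ _) (cong suc (length-filter-¬ P? xs))

applyUpTo-+ : (f : ℕ → A) (m n : ℕ) →
              applyUpTo f (m + n) ≡ applyUpTo f m ++ applyUpTo (f ∘ (m +_)) n
applyUpTo-+ f zero    n = refl
applyUpTo-+ f (suc m) n = cong (f 0 ∷_) (applyUpTo-+ (f ∘ suc) m n)

upTo-sorted : (n : ℕ) → AllPairs _<_ (upTo n)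
upTo-sorted n = AllPairs.applyUpTo⁺₁ id n (λ i<j _ → i<j)

length-concatMap : (f : A → List B) (g : A → ℕ) (xs : List A) →
                   (∀ {x} → x ∈ xs → length (f x) ≡ g x) → length (concatMap f xs) ≡ sum (map g xs)
length-concatMap f g []       _      = refl
length-concatMap f g (x ∷ xs) length≡ =
  trans (length-++ (f x)) (cong₂ _+_ (length≡ (here refl)) (length-concatMap f g xs (length≡ ∘ there)))

AllPairs-mapWith∈ : {R S : A → A → Set} {xs : List A} →
                    (∀ {x y} → x ∈ xs → y ∈ xs → R x y → S x y) → AllPairs R xs → AllPairs S xs
AllPairs-mapWith∈ f []         = []
AllPairs-mapWith∈ f (Rx ∷ Rxs) =
  All.tabulate (λ y∈ → f (here refl) (there y∈) (All.lookup Rx y∈))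
  ∷ AllPairs-mapWith∈ (λ x∈ y∈ → f (there x∈) (there y∈)) Rxs

AllPairs-lookup : {R : A → A → Set} {xs : List A} → AllPairs R xs →
                  ∀ {x y} → x ∈ xs → y ∈ xs → x ≢ y → R x y ⊎ R y x
AllPairs-lookup (Rx ∷ _)  (here refl) (here refl) x≢y = contradiction refl x≢y
AllPairs-lookup (Rx ∷ _)  (here refl) (there y∈)  _   = inj₁ (All.lookup Rx y∈)
AllPairs-lookup (Rx ∷ _)  (there x∈)  (here refl) _   = inj₂ (All.lookup Rx x∈)
AllPairs-lookup (_ ∷ Rxs) (there x∈)  (there y∈)  x≢y = AllPairs-lookup Rxs x∈ y∈ x≢y

sorted-⊆-antisym : {_<_ : A → A → Set} → Asymmetric _<_ → {xs ys : List A} →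
                   AllPairs _<_ xs → AllPairs _<_ ys → xs ⊆ ys → ys ⊆ xs → xs ≡ ys
sorted-⊆-antisym asym {[]}    {[]}    _ _ _ _ = refl
sorted-⊆-antisym asym {[]}    {y ∷ _} _ _ _ ys⊆xs with () ← ys⊆xs (here refl)
sorted-⊆-antisym asym {x ∷ _} {[]}    _ _ xs⊆ys _ with () ← xs⊆ys (here refl)
sorted-⊆-antisym {_<_ = _<_} asym {x ∷ xs} {y ∷ ys} (x<xs ∷ xs↑) (y<ys ∷ ys↑) xs⊆ys ys⊆xs =
  cong₂ _∷_ x≡y (sorted-⊆-antisym asym xs↑ ys↑ (tail⊆ x<xs x≡y xs⊆ys) (tail⊆ y<ys (sym x≡y) ys⊆xs))
  where
  x≡y : x ≡ y
  x≡y with xs⊆ys (here refl) | ys⊆xs (here refl)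
  ... | here x≡y   | _          = x≡y
  ... | there _    | here y≡x   = sym y≡x
  ... | there x∈ys | there y∈xs = contradiction (All.lookup y<ys x∈ys) (asym (All.lookup x<xs y∈xs))
  tail⊆ : ∀ {u v us vs} → All (u <_) us → u ≡ v → u ∷ us ⊆ v ∷ vs → us ⊆ vs
  tail⊆ u<us refl us⊆ c∈ with us⊆ (there c∈)
  ... | here refl  = contradiction (All.lookup u<us c∈) (λ u<u → asym u<u u<u)
  ... | there c∈vs = c∈vs

count : Decidable P → ℕ → ℕ
count P? n = length (filter P? (upTo n))

count-+ : (P? : Decidable P) (m n : ℕ) → count P? (m + n) ≡ count P? m + count (P? ∘ (m +_)) n
count-+ P? m n = begin
  length (filter P? (upTo (m + n)))
    ≡⟨ cong (length ∘ filter P?) (applyUpTo-+ id m n) ⟩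
  length (filter P? (upTo m ++ applyUpTo (m +_) n))
    ≡⟨ cong length (filter-++ P? (upTo m) _) ⟩
  length (filter P? (upTo m) ++ filter P? (applyUpTo (m +_) n))
    ≡⟨ length-++ (filter P? (upTo m)) ⟩
  count P? m + length (filter P? (applyUpTo (m +_) n))
    ≡⟨ cong (λ xs → count P? m + length (filter P? xs)) (map-upTo (m +_) n) ⟨
  count P? m + length (filter P? (map (m +_) (upTo n)))
    ≡⟨ cong (λ xs → count P? m + length xs) (filter-map P? (m +_) (upTo n)) ⟩
  count P? m + length (map (m +_) (filter (P? ∘ (m +_)) (upTo n)))
    ≡⟨ cong (count P? m +_) (length-map (m +_) (filter (P? ∘ (m +_)) (upTo n))) ⟩
  count P? m + count (P? ∘ (m +_)) n
    ∎
  where open ≡-Reasoning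

count-cong : (P? : Decidable P) (Q? : Decidable Q) {n : ℕ} →
             (∀ {i} → i < n → does (P? i) ≡ does (Q? i)) → count P? n ≡ count Q? n
count-cong P? Q? {n} agree = cong length (filter-cong P? Q? (All.map agree (All.all-upTo n)))

count-complement : (P? : Decidable P) (n : ℕ) → count P? n + count (¬? ∘ P?) n ≡ n
count-complement P? n = trans (length-filter-¬ P? (upTo n)) (length-upTo n)

count-periodic : (P? : Decidable P) (m : ℕ) .{{_ : NonZero m}} (t : ℕ) →
                 count (P? ∘ (_% m)) (t * m) ≡ t * count P? m
count-periodic P? m zero    = refl
count-periodic P? m (suc t) = begin
  count (P? ∘ (_% m)) (m + t * m)
    ≡⟨ count-+ (P? ∘ (_% m)) m (t * m) ⟩
  count (P? ∘ (_% m)) m + count (P? ∘ (_% m) ∘ (m +_)) (t * m)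
    ≡⟨ cong₂ _+_ (count-cong (P? ∘ (_% m)) P? {m} (cong (does ∘ P?) ∘ m<n⇒m%n≡m))
                 (count-cong (P? ∘ (_% m) ∘ (m +_)) (P? ∘ (_% m)) {t * m}
                   (λ {i} _ → cong (does ∘ P?) (%-remove-+ˡ i (∣-refl {m})))) ⟩
  count P? m + count (P? ∘ (_% m)) (t * m)
    ≡⟨ cong (count P? m +_) (count-periodic P? m t) ⟩
  count P? m + t * count P? m
    ∎
  where open ≡-Reasoning

count-pos : (P? : Decidable P) {n i : ℕ} → i < n → P i → 0 < count P? n
count-pos P? i<n Pi = filter-some P? (lose (∈-upTo⁺ i<n) Pi)

count-< : (P? : Decidable P) {n i : ℕ} → i < n → ¬ P i → count P? n < n
count-< P? {n} i<n ¬Pi =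
  subst (count P? n <_) (count-complement P? n) (m<m+n (count P? n) (count-pos (¬? ∘ P?) i<n ¬Pi))

count-witness : (P? : Decidable P) (n : ℕ) → 0 < count P? n → ∃ λ i → i < n × P i
count-witness P? n _ with filter P? (upTo n) in selected
... | i ∷ _ = let i∈ , Pi = ∈-filter⁻ P? (subst (i ∈_) (sym selected) (here refl)) in i , ∈-upTo⁻ i∈ , Pi

count-∁-witness : (P? : Decidable P) (n : ℕ) → count P? n < n → ∃ λ i → i < n × ¬ P i
count-∁-witness P? n count<n = count-witness (¬? ∘ P?) n (subst (0 <_) rest (m<n⇒0<n∸m count<n))
  where
  rest : n ∸ count P? n ≡ count (¬? ∘ P?) n
  rest = trans (cong (_∸ count P? n) (sym (count-complement P? n))) (m+n∸m≡n (count P? n) _)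

infixl 9 _‼_

_‼_ : List Bool → ℕ → Bool
[]      ‼ _     = false
(b ∷ _) ‼ zero  = b
(_ ∷ B) ‼ suc i = B ‼ i

‼-applyUpTo : (f : ℕ → Bool) {n i : ℕ} → i < n → applyUpTo f n ‼ i ≡ f i
‼-applyUpTo f {suc n} {zero}  _         = refl
‼-applyUpTo f {suc n} {suc i} (s≤s i<n) = ‼-applyUpTo (f ∘ suc) i<n

‼-ext : {B B′ : List Bool} → length B ≡ length B′ → (∀ {i} → i < length B → B ‼ i ≡ B′ ‼ i) → B ≡ B′
‼-ext {[]}    {[]}      _      _     = refl
‼-ext {b ∷ B} {b′ ∷ B′} length≡ agree =
  cong₂ _∷_ (agree (s≤s z≤n)) (‼-ext (suc-injective length≡) (agree ∘ s≤s))

count-‼ : (B : List Bool) → count (T? ∘ (B ‼_)) (length B) ≡ length (filter T? B)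
count-‼ []          = refl
count-‼ (true ∷ B)  = trans (count-+ (T? ∘ ((true ∷ B) ‼_)) 1 (length B)) (cong suc (count-‼ B))
count-‼ (false ∷ B) = trans (count-+ (T? ∘ ((false ∷ B) ‼_)) 1 (length B)) (count-‼ B)

subsets : ℕ → ℕ → List (List Bool)
subsets zero    zero    = [] ∷ []
subsets zero    (suc d) = []
subsets (suc n) zero    = map (false ∷_) (subsets n zero)
subsets (suc n) (suc d) = map (true ∷_) (subsets n d) ++ map (false ∷_) (subsets n (suc d))

length-subsets : (n d : ℕ) → length (subsets n d) ≡ n C d
length-subsets zero    zero    = refl
length-subsets zero    (suc d) = refl
length-subsets (suc n) zero    = trans (length-map (false ∷_) (subsets n zero)) (length-subsets n zero)
length-subsets (suc n) (suc d) = begin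
  length (map (true ∷_) (subsets n d) ++ map (false ∷_) (subsets n (suc d)))
    ≡⟨ length-++ (map (true ∷_) (subsets n d)) ⟩
  length (map (true ∷_) (subsets n d)) + length (map (false ∷_) (subsets n (suc d)))
    ≡⟨ cong₂ _+_ (length-map (true ∷_) (subsets n d)) (length-map (false ∷_) (subsets n (suc d))) ⟩
  length (subsets n d) + length (subsets n (suc d))
    ≡⟨ cong₂ _+_ (length-subsets n d) (length-subsets n (suc d)) ⟩
  n C d + n C suc d
    ≡⟨ nCk+nC[k+1]≡[n+1]C[k+1] n d ⟩
  suc n C suc d
    ∎
  where open ≡-Reasoning

∈-subsets⁻ : {n d : ℕ} {B : List Bool} → B ∈ subsets n d → length B ≡ n × length (filter T? B) ≡ d
∈-subsets⁻ {zero}  {zero}  (here refl) = refl , refl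
∈-subsets⁻ {suc n} {zero}  B∈ with B′ , B′∈ , refl ← ∈-map⁻ (false ∷_) B∈ =
  let length≡ , trues≡ = ∈-subsets⁻ B′∈ in cong suc length≡ , trues≡
∈-subsets⁻ {suc n} {suc d} B∈ with ∈-++⁻ (map (true ∷_) (subsets n d)) B∈
... | inj₁ B∈ᵗ with B′ , B′∈ , refl ← ∈-map⁻ (true ∷_) B∈ᵗ =
  let length≡ , trues≡ = ∈-subsets⁻ B′∈ in cong suc length≡ , cong suc trues≡
... | inj₂ B∈ᶠ with B′ , B′∈ , refl ← ∈-map⁻ (false ∷_) B∈ᶠ =
  let length≡ , trues≡ = ∈-subsets⁻ B′∈ in cong suc length≡ , trues≡

∈-subsets⁺ : (B : List Bool) → B ∈ subsets (length B) (length (filter T? B))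
∈-subsets⁺ []          = here refl
∈-subsets⁺ (true ∷ B)  = ∈-++⁺ˡ (∈-map⁺ (true ∷_) (∈-subsets⁺ B))
∈-subsets⁺ (false ∷ B) = false∷-∈ (length B) (length (filter T? B)) (∈-subsets⁺ B)
  where
  false∷-∈ : (n d : ℕ) → B ∈ subsets n d → false ∷ B ∈ subsets (suc n) d
  false∷-∈ n zero    B∈ = ∈-map⁺ (false ∷_) B∈
  false∷-∈ n (suc d) B∈ = ∈-++⁺ʳ (map (true ∷_) (subsets n d)) (∈-map⁺ (false ∷_) B∈)

subsets-unique : (n d : ℕ) → Unique (subsets n d)
subsets-unique zero    zero    = [] ∷ []
subsets-unique zero    (suc d) = []
subsets-unique (suc n) zero    = Unique.map⁺ ∷-injectiveʳ (subsets-unique n zero)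
subsets-unique (suc n) (suc d) =
  Unique.++⁺ (Unique.map⁺ ∷-injectiveʳ (subsets-unique n d))
             (Unique.map⁺ ∷-injectiveʳ (subsets-unique n (suc d))) heads-differ
  where
  heads-differ : ∀ {B} → ¬ (B ∈ map (true ∷_) (subsets n d) × B ∈ map (false ∷_) (subsets n (suc d)))
  heads-differ (B∈ᵗ , B∈ᶠ) with ∈-map⁻ (true ∷_) B∈ᵗ | ∈-map⁻ (false ∷_) B∈ᶠ
  ... | _ , _ , refl | _ , _ , ()

∈ᶜ-%ℕ : (z : ℤ) (n : ℕ) .{{_ : NonZero n}} → z ∈ᶜ (n , z %ℕ n)
∈ᶜ-%ℕ z n = ℤˢ.∣⇒∣ᵤ (ℤˢ.divides (z /ℕ n) (begin
  z ℤ.- ℤ.+ r                        ≡⟨ cong (ℤ._- ℤ.+ r) (a≡a%ℕn+[a/ℕn]*n z n) ⟩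
  ℤ.+ r ℤ.+ z /ℕ n ℤ.* ℤ.+ n ℤ.- ℤ.+ r ≡⟨ cancel (ℤ.+ r) (z /ℕ n ℤ.* ℤ.+ n) ⟩
  z /ℕ n ℤ.* ℤ.+ n                   ∎))
  where
  open ≡-Reasoning
  r = z %ℕ n
  cancel : ∀ a b → a ℤ.+ b ℤ.- a ≡ b
  cancel = solve-∀

∈ᶜ-refl : (n r : ℕ) → (ℤ.+ r) ∈ᶜ (n , r)
∈ᶜ-refl n r = subst (λ w → n ∣ ℤ.∣ w ∣) (sym (ℤ.+-inverseʳ (ℤ.+ r))) (n ℕ.∣0)

∈ᶜ-coarsen : {m M : ℕ} (z : ℤ) (s : ℕ) → m ∣ M → z ∈ᶜ (M , s) → z ∈ᶜ (m , s)
∈ᶜ-coarsen z s m∣M z∈ = ℕ.∣-trans m∣M z∈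

∈ᶜ-trans : {n : ℕ} (z : ℤ) (r s : ℕ) → z ∈ᶜ (n , s) → (ℤ.+ s) ∈ᶜ (n , r) → z ∈ᶜ (n , r)
∈ᶜ-trans {n} z r s z∈s s∈r = ℤˢ.∣⇒∣ᵤ (subst (ℤ.+ n ℤˢ.∣_) (telescope z (ℤ.+ s) (ℤ.+ r))
  (ℤˢ.∣m∣n⇒∣m+n (ℤˢ.∣ᵤ⇒∣ {ℤ.+ n} {z ℤ.- ℤ.+ s} z∈s) (ℤˢ.∣ᵤ⇒∣ {ℤ.+ n} {ℤ.+ s ℤ.- ℤ.+ r} s∈r)))
  where
  telescope : ∀ a b c → (a ℤ.- b) ℤ.+ (b ℤ.- c) ≡ a ℤ.- c
  telescope = solve-∀

∈ᶜ-reduce : {m M : ℕ} .{{_ : NonZero m}} (z : ℤ) (s : ℕ) → m ∣ M → z ∈ᶜ (M , s) → z ∈ᶜ (m , s % m)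
∈ᶜ-reduce {m} z s m∣M z∈ = ∈ᶜ-trans z (s % m) s (∈ᶜ-coarsen z s m∣M z∈) (∈ᶜ-%ℕ (ℤ.+ s) m)

∈ᶜ-distance : {n : ℕ} (z : ℤ) (r r′ : ℕ) → z ∈ᶜ (n , r) → z ∈ᶜ (n , r′) → n ∣ ℤ.∣ r ⊖ r′ ∣
∈ᶜ-distance {n} z r r′ z∈r z∈r′ =
  subst (λ w → n ∣ ℤ.∣ w ∣) (trans (shift z (ℤ.+ r) (ℤ.+ r′)) (ℤ.m-n≡m⊖n r r′))
    (ℤˢ.∣⇒∣ᵤ (ℤˢ.∣m∣n⇒∣m-n (ℤˢ.∣ᵤ⇒∣ {ℤ.+ n} {z ℤ.- ℤ.+ r′} z∈r′) (ℤˢ.∣ᵤ⇒∣ {ℤ.+ n} {z ℤ.- ℤ.+ r} z∈r)))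
  where
  shift : ∀ a b c → (a ℤ.- c) ℤ.- (a ℤ.- b) ≡ b ℤ.- c
  shift = solve-∀

∣-<⇒≡0 : {n x : ℕ} → n ∣ x → x < n → x ≡ 0
∣-<⇒≡0 {x = zero}  _   _   = refl
∣-<⇒≡0 {x = suc x} n∣x x<n = contradiction n∣x (ℕ.>⇒∤ x<n)

∈ᶜ-unique-≤ : {n r r′ : ℕ} (z : ℤ) → r ≤ r′ → r′ < n → z ∈ᶜ (n , r) → z ∈ᶜ (n , r′) → r ≡ r′
∈ᶜ-unique-≤ {n} {r} {r′} z r≤r′ r′<n z∈r z∈r′ =
  ≤-antisym r≤r′ (m∸n≡0⇒m≤n (∣-<⇒≡0 n∣r′∸r (≤-<-trans (m∸n≤m r′ r) r′<n)))
  where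
  n∣r′∸r : n ∣ r′ ∸ r
  n∣r′∸r = subst (n ∣_) (ℤ.∣⊖∣-≤ r≤r′) (∈ᶜ-distance z r r′ z∈r z∈r′)

∈ᶜ-unique : {n r r′ : ℕ} (z : ℤ) → r < n → r′ < n → z ∈ᶜ (n , r) → z ∈ᶜ (n , r′) → r ≡ r′
∈ᶜ-unique {r = r} {r′} z r<n r′<n z∈r z∈r′ with ≤-total r r′
... | inj₁ r≤r′ = ∈ᶜ-unique-≤ z r≤r′ r′<n z∈r z∈r′
... | inj₂ r′≤r = sym (∈ᶜ-unique-≤ z r′≤r r<n z∈r′ z∈r)

-- _<ᶜ_ is definitionally the lexicographic order on ℕ × ℕ.
open IsStrictPartialOrder (×-isStrictPartialOrder <-isStrictPartialOrder <-isStrictPartialOrder)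
  using () renaming (asym to <ᶜ-asym; trans to <ᶜ-trans)

exact-disjoint : {S : List Class} → Exact S → {c c′ : Class} → c ∈ S → c′ ∈ S → c ≢ c′ →
                 (z : ℤ) → ¬ (z ∈ᶜ c × z ∈ᶜ c′)
exact-disjoint exact c∈ c′∈ c≢c′ z with AllPairs-lookup exact c∈ c′∈ c≢c′
... | inj₁ disjoint = disjoint z
... | inj₂ disjoint = disjoint z ∘ swap

modulus≥2 : {S : List Class} {n : ℕ} → All Canonical S → Any (λ c → modulus c ≡ n) S → 2 ≤ n
modulus≥2 canonical some with c , c∈ , refl ← find some = proj₁ (All.lookup canonical c∈)

m<[1+q]*m : {m q : ℕ} .{{_ : NonZero m}} → 0 < q → m < suc q * m
m<[1+q]*m {m} {q} 0<q = subst (m <_) (*-comm m (suc q)) (m<m*n m (suc q) (s≤s 0<q))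

factors-positive : {n q d : ℕ} → 0 < n → n ≡ q * d → 0 < q × 0 < d
factors-positive {q = q} {d} 0<n n≡q*d = >-nonZero⁻¹ q {{q≢0}} , >-nonZero⁻¹ d {{d≢0}}
  where
  instance
    q*d≢0 : NonZero (q * d)
    q*d≢0 = >-nonZero (subst (0 <_) n≡q*d 0<n)
  q≢0 : NonZero q
  q≢0 = m*n≢0⇒m≢0 q
  d≢0 : NonZero d
  d≢0 = m*n≢0⇒n≢0 q

multiple-cofactor : {m M : ℕ} → 2 ≤ M → M ≢ m → m ∣ M → ∃ λ q → 0 < q × M ≡ suc q * m
multiple-cofactor     2≤M _   (divides zero          refl) = contradiction 2≤M λ ()
multiple-cofactor {m} _   M≢m (divides (suc zero)    refl) = contradiction (+-identityʳ m) M≢m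
multiple-cofactor     _   _   (divides (suc (suc q)) refl) = suc q , s≤s z≤n , refl

module Refinement (m M : ℕ) .{{_ : NonZero m}} {P : ℕ → Set} (P? : Decidable P) where

  keptClasses : List Class
  keptClasses = map (m ,′_) (filter (¬? ∘ P?) (upTo m))

  refinedClasses : List Class
  refinedClasses = map (M ,′_) (filter (P? ∘ (_% m)) (upTo M))

  refinement : List Class
  refinement = keptClasses ++ refinedClasses

  data Member : Class → Set where
    kept    : {r : ℕ} → r < m → ¬ P r → Member (m , r)
    refined : {s : ℕ} → s < M → P (s % m) → Member (M , s)

  member : {c : Class} → c ∈ refinement → Member c
  member c∈ with ∈-++⁻ keptClasses c∈
  ... | inj₁ c∈ᵏ with r , r∈ , refl ← ∈-map⁻ (m ,′_) c∈ᵏ =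
    let r∈↑ , ¬Pr = ∈-filter⁻ (¬? ∘ P?) r∈ in kept (∈-upTo⁻ r∈↑) ¬Pr
  ... | inj₂ c∈ʳ with s , s∈ , refl ← ∈-map⁻ (M ,′_) c∈ʳ =
    let s∈↑ , Ps = ∈-filter⁻ (P? ∘ (_% m)) s∈ in refined (∈-upTo⁻ s∈↑) Ps

  kept⁺ : {r : ℕ} → r < m → ¬ P r → (m , r) ∈ refinement
  kept⁺ r<m ¬Pr = ∈-++⁺ˡ (∈-map⁺ (m ,′_) (∈-filter⁺ (¬? ∘ P?) (∈-upTo⁺ r<m) ¬Pr))

  refined⁺ : {s : ℕ} → s < M → P (s % m) → (M , s) ∈ refinement
  refined⁺ s<M Ps = ∈-++⁺ʳ keptClasses (∈-map⁺ (M ,′_) (∈-filter⁺ (P? ∘ (_% m)) (∈-upTo⁺ s<M) Ps))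

  kept⁻ : M ≢ m → {r : ℕ} → (m , r) ∈ refinement → ¬ P r
  kept⁻ M≢m r∈ with member r∈
  ... | kept _ ¬Pr  = ¬Pr
  ... | refined _ _ = contradiction refl M≢m

  refinement-sorted : m < M → AllPairs _<ᶜ_ refinement
  refinement-sorted m<M = AllPairs.++⁺ (residues-sorted m (¬? ∘ P?) m) (residues-sorted M (P? ∘ (_% m)) M)
    (All.map⁺ (All.universal (λ _ → All.map⁺ (All.universal (λ _ → inj₁ m<M) _)) _))
    where
    residues-sorted : (n : ℕ) {Q : ℕ → Set} (Q? : Decidable Q) (N : ℕ) →
                      AllPairs _<ᶜ_ (map (n ,′_) (filter Q? (upTo N)))
    residues-sorted n Q? N =
      AllPairs.map⁺ (AllPairs.map (λ r<r′ → inj₂ (refl , r<r′)) (AllPairs.filter⁺ Q? (upTo-sorted N)))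

  refinement-isSystem : 2 ≤ m → m < M → IsSystem refinement
  refinement-isSystem 2≤m m<M = All.tabulate (canonical ∘ member) , AllPairs⇒Linked (refinement-sorted m<M)
    where
    canonical : {c : Class} → Member c → Canonical c
    canonical (kept r<m _)    = 2≤m , r<m
    canonical (refined s<M _) = ≤-trans 2≤m (<⇒≤ m<M) , s<M

  refinement-covering : m ∣ M → m < M → Covering refinement
  refinement-covering m∣M m<M z = cover (P? (s % m))
    where
    instance
      M≢0 : NonZero M
      M≢0 = >-nonZero (≤-trans (s≤s z≤n) m<M)
    s : ℕ
    s = z %ℕ M
    cover : Dec (P (s % m)) → Any (z ∈ᶜ_) refinement
    cover (yes Ps) = lose (refined⁺ (n%ℕd<d z M) Ps) (∈ᶜ-%ℕ z M)
    cover (no ¬Ps) = lose (kept⁺ (m%n<n s m) ¬Ps) (∈ᶜ-reduce z s m∣M (∈ᶜ-%ℕ z M))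

  kept-refined-disjoint : m ∣ M → {r s : ℕ} → r < m → ¬ P r → P (s % m) →
                          (z : ℤ) → ¬ (z ∈ᶜ (m , r) × z ∈ᶜ (M , s))
  kept-refined-disjoint m∣M {r} {s} r<m ¬Pr Ps z (z∈r , z∈s) =
    ¬Pr (subst P (∈ᶜ-unique z (m%n<n s m) r<m (∈ᶜ-reduce z s m∣M z∈s) z∈r) Ps)

  members-disjoint : m ∣ M → {c c′ : Class} → Member c → Member c′ → c ≢ c′ →
                     (z : ℤ) → ¬ (z ∈ᶜ c × z ∈ᶜ c′)
  members-disjoint m∣M (kept r<m _) (kept r′<m _) c≢c′ z (z∈ , z∈′) =
    c≢c′ (cong (m ,_) (∈ᶜ-unique z r<m r′<m z∈ z∈′))
  members-disjoint m∣M (refined s<M _) (refined s′<M _) c≢c′ z (z∈ , z∈′) =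
    c≢c′ (cong (M ,_) (∈ᶜ-unique z s<M s′<M z∈ z∈′))
  members-disjoint m∣M (kept r<m ¬Pr) (refined _ Ps) _ z (z∈ , z∈′) =
    kept-refined-disjoint m∣M r<m ¬Pr Ps z (z∈ , z∈′)
  members-disjoint m∣M (refined _ Ps) (kept r<m ¬Pr) _ z (z∈ , z∈′) =
    kept-refined-disjoint m∣M r<m ¬Pr Ps z (z∈′ , z∈)

  refinement-exact : m ∣ M → m < M → Exact refinement
  refinement-exact m∣M m<M = AllPairs-mapWith∈
    (λ c∈ c′∈ c<c′ → members-disjoint m∣M (member c∈) (member c′∈) (λ { refl → <ᶜ-asym c<c′ c<c′ }))
    (refinement-sorted m<M)

  length-refinement : {q : ℕ} → M ≡ suc q * m → length refinement ≡ m + q * count P? m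
  length-refinement {q} refl = begin
    length refinement
      ≡⟨ length-++ keptClasses ⟩
    length keptClasses + length refinedClasses
      ≡⟨ cong₂ _+_ length-kept length-refined ⟩
    count (¬? ∘ P?) m + count (P? ∘ (_% m)) (suc q * m)
      ≡⟨ cong (count (¬? ∘ P?) m +_) (count-periodic P? m (suc q)) ⟩
    count (¬? ∘ P?) m + (d + q * d)
      ≡⟨ +-assoc (count (¬? ∘ P?) m) d (q * d) ⟨
    count (¬? ∘ P?) m + d + q * d
      ≡⟨ cong (_+ q * d) (trans (+-comm (count (¬? ∘ P?) m) d) (count-complement P? m)) ⟩
    m + q * d
      ∎
    where
    open ≡-Reasoning
    d = count P? m
    length-kept : length keptClasses ≡ count (¬? ∘ P?) m
    length-kept = length-map (m ,′_) (filter (¬? ∘ P?) (upTo m))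
    length-refined : length refinedClasses ≡ count (P? ∘ (_% m)) M
    length-refined = length-map (M ,′_) (filter (P? ∘ (_% m)) (upTo M))

  refinement-twoModuli : m ∣ M → m < M → (∃ λ r → r < m × ¬ P r) → (∃ λ r → r < m × P r) →
                         TwoModuli m refinement
  refinement-twoModuli m∣M m<M (r , r<m , ¬Pr) (r′ , r′<m , Pr′) =
    M , >⇒≢ m<M , m∣M , All.tabulate (modulus-of ∘ member) , lose (kept⁺ r<m ¬Pr) refl ,
    lose (refined⁺ (<-trans r′<m m<M) (subst P (sym (m<n⇒m%n≡m r′<m)) Pr′)) refl
    where
    modulus-of : {c : Class} → Member c → modulus c ≡ m ⊎ modulus c ≡ M
    modulus-of (kept _ _)    = inj₁ refl
    modulus-of (refined _ _) = inj₂ refl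

  kept-witness : M ≢ m → Any (λ c → modulus c ≡ m) refinement → ∃ λ r → r < m × ¬ P r
  kept-witness M≢m some with c , c∈ , modulus≡m ← find some with member c∈ | modulus≡m
  ... | kept {r} r<m ¬Pr | _   = r , r<m , ¬Pr
  ... | refined _ _      | M≡m = contradiction M≡m M≢m

  refined-witness : M ≢ m → Any (λ c → modulus c ≡ M) refinement → ∃ λ r → r < m × P r
  refined-witness M≢m some with c , c∈ , modulus≡M ← find some with member c∈ | modulus≡M
  ... | kept _ _         | m≡M = contradiction (sym m≡M) M≢m
  ... | refined {s} _ Ps | _   = s % m , m%n<n s m , Ps

open Refinement public using (refinement)

refinement-cong : {m M : ℕ} .{{_ : NonZero m}} (P? : Decidable P) (Q? : Decidable Q) →
                  (∀ {r} → r < m → does (P? r) ≡ does (Q? r)) → refinement m M P? ≡ refinement m M Q?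
refinement-cong {m = m} {M} P? Q? agree = cong₂ _++_
  (cong (map (m ,′_)) (filter-cong (¬? ∘ P?) (¬? ∘ Q?) (All.map (cong not ∘ agree) (All.all-upTo m))))
  (cong (map (M ,′_)) (filter-cong (P? ∘ (_% m)) (Q? ∘ (_% m)) (All.universal (λ s → agree (m%n<n s m)) (upTo M))))

refinement-injective : {m M M′ : ℕ} .{{_ : NonZero m}} {B B′ : List Bool} → M ≢ m → M′ ≢ m →
                       length B ≡ m → length B′ ≡ m →
                       refinement m M (T? ∘ (B ‼_)) ≡ refinement m M′ (T? ∘ (B′ ‼_)) → B ≡ B′
refinement-injective {m} {M} {M′} {B = B} {B′} M≢m M′≢m refl length-B′ same =
  ‼-ext (sym length-B′) λ {i} i<m → bits-agree
    (λ ¬Bi → Refinement.kept⁻ m M′ (T? ∘ (B′ ‼_)) M′≢m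
      (subst ((m , i) ∈_) same (Refinement.kept⁺ m M (T? ∘ (B ‼_)) i<m ¬Bi)))
    (λ ¬B′i → Refinement.kept⁻ m M (T? ∘ (B ‼_)) M≢m
      (subst ((m , i) ∈_) (sym same) (Refinement.kept⁺ m M′ (T? ∘ (B′ ‼_)) i<m ¬B′i)))
  where
  bits-agree : {a b : Bool} → (¬ T a → ¬ T b) → (¬ T b → ¬ T a) → a ≡ b
  bits-agree {false} {false} _ _ = refl
  bits-agree {true}  {true}  _ _ = refl
  bits-agree {false} {true}  f _ = contradiction _ (f λ ())
  bits-agree {true}  {false} _ g = contradiction _ (g λ ())

refinement-counted : {m : ℕ} .{{_ : NonZero m}} (P? : Decidable P) {q k : ℕ} →
                     0 < count P? m → count P? m < m → 0 < q → k ≡ m + q * count P? m →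
                     Counted m k (refinement m (suc q * m) P?)
refinement-counted {m = m} P? {q} 0<d d<m 0<q refl =
  refinement-isSystem (≤-trans (s≤s 0<d) d<m) m<M , refinement-covering m∣M m<M ,
  refinement-exact m∣M m<M , length-refinement {q} refl ,
  refinement-twoModuli m∣M m<M (count-∁-witness P? m d<m) (count-witness P? m 0<d)
  where
  open Refinement m (suc q * m) P?
  m∣M : m ∣ suc q * m
  m∣M = divides (suc q) refl
  m<M : m < suc q * m
  m<M = m<[1+q]*m 0<q

unused? : (m : ℕ) (S : List Class) → Decidable (λ r → (m , r) ∉ S)
unused? m S r = ¬? ((m , r) ∈? S)

module _ {m M : ℕ} .{{_ : NonZero m}} (m∣M : m ∣ M) (m<M : m < M) {S : List Class}
         (canonical : All Canonical S) (sorted : AllPairs _<ᶜ_ S) (covering : Covering S) (exact : Exact S)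
         (moduli : All (λ c → modulus c ≡ m ⊎ modulus c ≡ M) S) where

  open Refinement m M (unused? m S) hiding (refinement)

  private
    S⊆refinement : S ⊆ refinement m M (unused? m S)
    S⊆refinement {n , r} c∈ with All.lookup canonical c∈ | All.lookup moduli c∈
    ... | _ , r<n | inj₁ refl = kept⁺ r<n λ r-unused → r-unused c∈
    ... | _ , r<n | inj₂ refl = refined⁺ r<n λ c′∈ →
      exact-disjoint exact c′∈ c∈ (<⇒≢ m<M ∘ cong proj₁) (ℤ.+ r) (∈ᶜ-%ℕ (ℤ.+ r) m , ∈ᶜ-refl M r)

    refinement⊆S : refinement m M (unused? m S) ⊆ S
    refinement⊆S c∈ with member c∈
    ... | kept {r} _ used = decidable-stable ((m , r) ∈? S) used
    ... | refined {s} s<M s%m-unused with (n , r) , c∈S , s∈c ← find (covering (ℤ.+ s))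
                                      | All.lookup canonical c∈S | All.lookup moduli c∈S
    ...   | _ , r<n | inj₁ refl = contradiction
            (subst (λ r → (m , r) ∈ S) (∈ᶜ-unique (ℤ.+ s) r<n (m%n<n s m) s∈c (∈ᶜ-%ℕ (ℤ.+ s) m)) c∈S)
            s%m-unused
    ...   | _ , r<n | inj₂ refl =
            subst (λ r → (M , r) ∈ S) (∈ᶜ-unique (ℤ.+ s) r<n s<M s∈c (∈ᶜ-refl M s)) c∈S

  exactCovering≡refinement : S ≡ refinement m M (unused? m S)
  exactCovering≡refinement =
    sorted-⊆-antisym <ᶜ-asym sorted (refinement-sorted m<M) S⊆refinement refinement⊆S

divisorsBelow : ℕ → ℕ → List ℕ
divisorsBelow m k = filter (λ d → d ∣? (k ∸ m)) (upTo m)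

systemOf : (m q : ℕ) .{{_ : NonZero m}} → List Bool → List Class
systemOf m q B = refinement m (suc q * m) (T? ∘ (B ‼_))

-- The no case does not occur for d ∈ divisorsBelow m k.
systemsWith : (m k d : ℕ) .{{_ : NonZero m}} → Dec (d ∣ k ∸ m) → List (List Class)
systemsWith m k d (yes (divides q _)) = map (systemOf m q) (subsets m d)
systemsWith m k d (no _)              = []

systems : (m k : ℕ) .{{_ : NonZero m}} → List (List Class)
systems m k = concatMap (λ d → systemsWith m k d (d ∣? (k ∸ m))) (divisorsBelow m k)

module _ {m k : ℕ} .{{_ : NonZero m}} where

  ∈-systemsWith⁻ : {d : ℕ} (d∣? : Dec (d ∣ k ∸ m)) {S : List Class} → S ∈ systemsWith m k d d∣? →
                   ∃₂ λ q B → k ∸ m ≡ q * d × B ∈ subsets m d × S ≡ systemOf m q B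
  ∈-systemsWith⁻ (yes (divides q k∸m≡q*d)) S∈ with B , B∈ , refl ← ∈-map⁻ _ S∈ = q , B , k∸m≡q*d , B∈ , refl

  ∈-systemsWith⁺ : {d q : ℕ} {B : List Bool} → 0 < d → k ∸ m ≡ q * d → B ∈ subsets m d →
                   (d∣? : Dec (d ∣ k ∸ m)) → systemOf m q B ∈ systemsWith m k d d∣?
  ∈-systemsWith⁺ {q = q} 0<d k∸m≡q*d B∈ (no d∤) = contradiction (divides q k∸m≡q*d) d∤
  ∈-systemsWith⁺ {d} {q} 0<d k∸m≡q*d B∈ (yes (divides q′ k∸m≡q′*d))
    with refl ← *-cancelʳ-≡ q′ q d {{>-nonZero 0<d}} (trans (sym k∸m≡q′*d) k∸m≡q*d) =
    ∈-map⁺ (systemOf m q) B∈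

  length-systemsWith : {d : ℕ} → d ∣ k ∸ m → (d∣? : Dec (d ∣ k ∸ m)) → length (systemsWith m k d d∣?) ≡ m C d
  length-systemsWith {d} _  (yes (divides q _)) = trans (length-map _ (subsets m d)) (length-subsets m d)
  length-systemsWith     d∣ (no d∤)             = contradiction d∣ d∤

  length-systems : length (systems m k) ≡ formula m k
  length-systems = length-concatMap (λ d → systemsWith m k d (d ∣? (k ∸ m))) (m C_) (divisorsBelow m k)
    (λ {d} d∈ → length-systemsWith (proj₂ (∈-filter⁻ (λ d → d ∣? (k ∸ m)) {xs = upTo m} d∈)) (d ∣? (k ∸ m)))

  systemOf-injective : {B B′ : List Bool} (q d q′ d′ : ℕ) → m < k → k ∸ m ≡ q * d → k ∸ m ≡ q′ * d′ →
                       B ∈ subsets m d → B′ ∈ subsets m d′ → systemOf m q B ≡ systemOf m q′ B′ → B ≡ B′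
  systemOf-injective q d q′ d′ m<k k∸m≡q*d k∸m≡q′*d′ B∈ B′∈ =
    refinement-injective (multiple≢ q d k∸m≡q*d) (multiple≢ q′ d′ k∸m≡q′*d′)
      (proj₁ (∈-subsets⁻ {m} {d} B∈)) (proj₁ (∈-subsets⁻ {m} {d′} B′∈))
    where
    multiple≢ : (q d : ℕ) → k ∸ m ≡ q * d → suc q * m ≢ m
    multiple≢ q d k∸m≡q*d = >⇒≢ (m<[1+q]*m (proj₁ (factors-positive {q = q} {d} (m<n⇒0<n∸m m<k) k∸m≡q*d)))

  systems-unique : m < k → Unique (systems m k)
  systems-unique m<k = Unique.concat⁺ (All.map⁺ (All.tabulate block-unique))
    (AllPairs.map⁺ (AllPairs-mapWith∈ blocks-disjoint (Unique.filter⁺ (λ d → d ∣? (k ∸ m)) (Unique.upTo⁺ m))))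
    where
    block-unique : ∀ {d} → d ∈ divisorsBelow m k → Unique (systemsWith m k d (d ∣? (k ∸ m)))
    block-unique {d} _ with d ∣? (k ∸ m)
    ... | no _                    = []
    ... | yes (divides q k∸m≡q*d) = AllPairs.map⁺ (AllPairs-mapWith∈
          (λ B∈ B′∈ B≢B′ same → B≢B′ (systemOf-injective q d q d m<k k∸m≡q*d k∸m≡q*d B∈ B′∈ same))
          (subsets-unique m d))
    blocks-disjoint : ∀ {d d′} → d ∈ divisorsBelow m k → d′ ∈ divisorsBelow m k → d ≢ d′ →
                      Disjoint (systemsWith m k d (d ∣? (k ∸ m))) (systemsWith m k d′ (d′ ∣? (k ∸ m)))
    blocks-disjoint {d} {d′} _ _ d≢d′ (S∈ , S∈′)
      with q , B , k∸m≡q*d , B∈ , refl ← ∈-systemsWith⁻ (d ∣? (k ∸ m)) S∈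
         | q′ , B′ , k∸m≡q′*d′ , B′∈ , same ← ∈-systemsWith⁻ (d′ ∣? (k ∸ m)) S∈′
      with refl ← systemOf-injective q d q′ d′ m<k k∸m≡q*d k∸m≡q′*d′ B∈ B′∈ same =
      d≢d′ (trans (sym (proj₂ (∈-subsets⁻ {m} {d} B∈))) (proj₂ (∈-subsets⁻ {m} {d′} B′∈)))

  systemOf-counted : {B : List Bool} (q d : ℕ) → m < k → d < m → k ∸ m ≡ q * d → B ∈ subsets m d →
                     Counted m k (systemOf m q B)
  systemOf-counted {B} q d m<k d<m k∸m≡q*d B∈ =
    refinement-counted (T? ∘ (B ‼_)) {q} (subst (0 <_) (sym weight) 0<d) (subst (_< m) (sym weight) d<m) 0<q k≡
    where
    0<q = proj₁ (factors-positive {q = q} {d} (m<n⇒0<n∸m m<k) k∸m≡q*d)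
    0<d = proj₂ (factors-positive {q = q} {d} (m<n⇒0<n∸m m<k) k∸m≡q*d)
    weight : count (T? ∘ (B ‼_)) m ≡ d
    weight = let length≡m , trues≡d = ∈-subsets⁻ {m} {d} B∈ in
      trans (cong (count (T? ∘ (B ‼_))) (sym length≡m)) (trans (count-‼ B) trues≡d)
    k≡ : k ≡ m + q * count (T? ∘ (B ‼_)) m
    k≡ = trans (sym (m+[n∸m]≡n (<⇒≤ m<k))) (cong (m +_) (trans k∸m≡q*d (cong (q *_) (sym weight))))

  ∈-systems⁻ : m < k → {S : List Class} → S ∈ systems m k → Counted m k S
  ∈-systems⁻ m<k S∈
    with d , d∈ , S∈d ← find (∈-concatMap⁻ (λ d → systemsWith m k d (d ∣? (k ∸ m))) S∈)
    with q , B , k∸m≡q*d , B∈ , refl ← ∈-systemsWith⁻ (d ∣? (k ∸ m)) S∈d =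
    systemOf-counted q d m<k (∈-upTo⁻ (proj₁ (∈-filter⁻ (λ d → d ∣? (k ∸ m)) {xs = upTo m} d∈))) k∸m≡q*d B∈

  refinement∈systems : (P? : Decidable P) (q : ℕ) → 0 < q →
                       let R = refinement m (suc q * m) P? in
                       length R ≡ k → Any (λ c → modulus c ≡ m) R → Any (λ c → modulus c ≡ suc q * m) R →
                       R ∈ systems m k
  refinement∈systems P? q 0<q refl some-m some-M =
    ∈-concatMap⁺ (λ d → systemsWith m k d (d ∣? (k ∸ m)))
      (lose d∈ (subst (_∈ systemsWith m k d (d ∣? (k ∸ m))) (sym coded)
        (∈-systemsWith⁺ {q = q} 0<d k∸m≡q*d χ∈ (d ∣? (k ∸ m)))))
    where
    open Refinement m (suc q * m) P? using (kept-witness; refined-witness; length-refinement)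
    M≢m = >⇒≢ (m<[1+q]*m 0<q)
    d = count P? m
    0<d : 0 < d
    0<d = let r , r<m , Pr = refined-witness M≢m some-M in count-pos P? r<m Pr
    d<m : d < m
    d<m = let r , r<m , ¬Pr = kept-witness M≢m some-m in count-< P? r<m ¬Pr
    k∸m≡q*d : k ∸ m ≡ q * d
    k∸m≡q*d = trans (cong (_∸ m) (length-refinement {q} refl)) (m+n∸m≡n m (q * d))
    d∈ : d ∈ divisorsBelow m k
    d∈ = ∈-filter⁺ (λ d → d ∣? (k ∸ m)) (∈-upTo⁺ d<m) (divides q k∸m≡q*d)
    χ : List Bool
    χ = applyUpTo (does ∘ P?) m
    bits : ∀ {r} → r < m → does (T? (χ ‼ r)) ≡ does (P? r)
    bits = ‼-applyUpTo (does ∘ P?)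
    coded : refinement m (suc q * m) P? ≡ systemOf m q χ
    coded = refinement-cong P? (T? ∘ (χ ‼_)) (sym ∘ bits)
    weight : length (filter T? χ) ≡ d
    weight = begin
      length (filter T? χ)            ≡⟨ count-‼ χ ⟨
      count (T? ∘ (χ ‼_)) (length χ)  ≡⟨ cong (count (T? ∘ (χ ‼_))) (length-applyUpTo (does ∘ P?) m) ⟩
      count (T? ∘ (χ ‼_)) m           ≡⟨ count-cong (T? ∘ (χ ‼_)) P? bits ⟩
      d                               ∎
      where open ≡-Reasoning
    χ∈ : χ ∈ subsets m d
    χ∈ = subst₂ (λ n w → χ ∈ subsets n w) (length-applyUpTo (does ∘ P?) m) weight (∈-subsets⁺ χ)

  ∈-systems⁺ : {S : List Class} → Counted m k S → S ∈ systems m k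
  ∈-systems⁺ ((canonical , linked) , covering , exact , refl , M , M≢m , m∣M , moduli , some-m , some-M)
    with q , 0<q , refl ← multiple-cofactor (modulus≥2 canonical some-M) M≢m m∣M =
    subst (_∈ systems m k) (sym S≡R)
      (refinement∈systems (unused? m _) q 0<q (sym (cong length S≡R))
        (subst (Any _) S≡R some-m) (subst (Any _) S≡R some-M))
    where
    S≡R = exactCovering≡refinement m∣M (m<[1+q]*m 0<q) canonical (Linked⇒AllPairs <ᶜ-trans linked)
            covering exact moduli

proposition2p13 : (m k : ℕ) → m < k →
    Σ (List (List Class)) λ L →
      Unique L × length L ≡ formula m k × ((S : List Class) → (S ∈ L ⇔ Counted m k S))
proposition2p13 zero k _ =
  [] , [] , refl , λ S → mk⇔ (λ ()) λ counted → contradiction (modulus-m≥2 counted) λ ()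
  where
  modulus-m≥2 : {S : List Class} → Counted zero k S → 2 ≤ zero
  modulus-m≥2 ((canonical , _) , _ , _ , _ , _ , _ , _ , _ , some-m , _) = modulus≥2 canonical some-m
proposition2p13 m@(suc _) k m<k =
  systems m k , systems-unique m<k , length-systems {m} {k} , λ S → mk⇔ (∈-systems⁻ m<k) ∈-systems⁺
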